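{- Let $m \ge 3$, $r\ge 1$ be integers with $\lceil m/2\rceil < 2r < m$. Then $\operatorname{Z}(Wb(m,r)) \le 2r$.
   Context: The web graph $Wb(m,r)$ is obtained from the Cartesian product $C_m \Box P_r$, with vertices $v_{i,j}$ ($i\in[m]$, $j\in[r]$), where $v_{i,j_1}\sim v_{i,j_2}$ iff $|j_1-j_2|=1$ and $v_{i_1,j}\sim v_{i_2,j}$ iff $|i_1-i_2|=1$ or $\{i_1,i_2\}=\{1,m\}$, by adding pendant vertices $p_1,\dots,p_m$ with $p_i$ adjacent only to $v_{i,1}$. Zero forcing: a blue vertex with exactly one white neighbor may color that neighbor blue; a zero forcing set is an initial blue set from which repeated application colors all vertices blue; $\operatorname{Z}(G)$ is the minimum size of a zero forcing set. -}

module Defs where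

open import Level using (0ℓ)
open import Data.Nat using (ℕ; zero; suc; _≤_)
open import Data.Fin using (Fin; toℕ)
open import Data.Product using (_×_; _,_; ∃-syntax)
open import Data.Sum using (_⊎_; inj₁; inj₂)
open import Data.Empty using (⊥)
open import Data.List using (List; length)
open import Data.List.Membership.Propositional using (_∈_)
open import Data.List.Relation.Unary.Unique.Propositional using (Unique)
open import Relation.Binary.PropositionalEquality using (_≡_; _≢_)

record Graph : Set₁ where
  field
    V   : Set
    _~_ : V → V → Set
open Graph public

-- Zero forcing closure of an initial blue set S (given as a list of vertices).
data Blue (G : Graph) (S : List (V G)) : V G → Set where
  init  : ∀ {v} → v ∈ S → Blue G S v
  force : ∀ {u w} → Blue G S u → _~_ G u w
        → (∀ x → _~_ G u x → x ≢ w → Blue G S x)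
        → Blue G S w

IsZeroForcingSet : (G : Graph) → List (V G) → Set
IsZeroForcingSet G S = ∀ v → Blue G S v

-- Z(G) ≤ k : there is a zero forcing set (of distinct vertices) of size ≤ k.
-- Since Z(G) is the minimum size of a zero forcing set, this is exactly Z(G) ≤ k.
Z≤ : Graph → ℕ → Set
Z≤ G k = ∃[ S ] (Unique S × IsZeroForcingSet G S × length S ≤ k)

-- Adjacency in the cycle C_m on Fin m (indices 0..m-1, i.e. shifted by one).
CycAdj : (m : ℕ) → Fin m → Fin m → Set
CycAdj m i i' =
  (toℕ i' ≡ suc (toℕ i)) ⊎ (toℕ i ≡ suc (toℕ i'))
  ⊎ (toℕ i ≡ 0 × suc (toℕ i') ≡ m) ⊎ (suc (toℕ i) ≡ m × toℕ i' ≡ 0)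

PathAdj : (r : ℕ) → Fin r → Fin r → Set
PathAdj r j j' = (toℕ j' ≡ suc (toℕ j)) ⊎ (toℕ j ≡ suc (toℕ j'))

-- Vertices of Wb(m,r): inj₁ (i , j) is v_{i+1,j+1}; inj₂ i is the pendant p_{i+1}.
WbV : ℕ → ℕ → Set
WbV m r = (Fin m × Fin r) ⊎ Fin m

WbAdj : (m r : ℕ) → WbV m r → WbV m r → Set
WbAdj m r (inj₁ (i , j)) (inj₁ (i' , j')) =
  (i ≡ i' × PathAdj r j j') ⊎ (j ≡ j' × CycAdj m i i')
WbAdj m r (inj₁ (i , j)) (inj₂ k) = k ≡ i × toℕ j ≡ 0
WbAdj m r (inj₂ k) (inj₁ (i , j)) = k ≡ i × toℕ j ≡ 0
WbAdj m r (inj₂ k) (inj₂ k') = ⊥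

Wb : ℕ → ℕ → Graph
Wb m r = record { V = WbV m r ; _~_ = WbAdj m r }

-- Colour the pendants of 2r consecutive columns.  Each pendant forces the vertex above it, and
-- these force a pyramid of rows.  Filling the diagonals beside the pyramid one after another,
-- each from the top down, completes r + 1 columns from either end of the block, hence the block.
-- Two full columns, the outer one with a blue pendant, start a staircase along the cycle that
-- loses one row per column.  As ⌈m/2⌉ < 2r gives m ≤ 4r, the block can be placed with at most
-- r columns on either side of it, so both staircases reach the top row.  Once the top row is
-- blue, every vertex forces the one below it, down to the pendants.
module Submission where

open import Defs
open import Data.Nat using (ℕ; zero; suc; pred; _+_; _∸_; _*_; _≤_; _<_; _≤?_; _<?_; z≤n; s≤s; z<s; ⌈_/2⌉; ⌊_/2⌋; >-nonZero)
open import Data.Nat.Properties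
open import Data.Nat.Tactic.RingSolver using (solve-∀)
open import Data.Fin using (Fin; toℕ; fromℕ<)
open import Data.Fin.Properties using (toℕ-fromℕ<; toℕ-injective; toℕ<n)
open import Data.Product using (_×_; _,_)
open import Data.Sum using (_⊎_; inj₁; inj₂)
open import Data.Sum.Properties using (inj₂-injective)
open import Data.Empty using (⊥-elim)
open import Data.List using (List; map; allFin; length)
open import Data.List.Properties using (length-map; length-tabulate)
open import Data.List.Membership.Propositional using (_∈_)
open import Data.List.Membership.Propositional.Properties using (∈-map⁺; ∈-allFin)
open import Data.List.Relation.Unary.Unique.Propositional using (Unique)
open import Data.List.Relation.Unary.Unique.Propositional.Properties using (map⁺; allFin⁺)
open import Relation.Binary.PropositionalEquality
open import Relation.Nullary using (yes; no)

CycAdjℕ : ℕ → ℕ → ℕ → Set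
CycAdjℕ m c c' = (c' ≡ suc c) ⊎ (c ≡ suc c') ⊎ (c ≡ 0 × suc c' ≡ m) ⊎ (suc c ≡ m × c' ≡ 0)

cycAdjℕ-sym : ∀ {m c c'} → CycAdjℕ m c c' → CycAdjℕ m c' c
cycAdjℕ-sym (inj₁ e)                       = inj₂ (inj₁ e)
cycAdjℕ-sym (inj₂ (inj₁ e))                = inj₁ e
cycAdjℕ-sym (inj₂ (inj₂ (inj₁ (e , e')))) = inj₂ (inj₂ (inj₂ (e' , e)))
cycAdjℕ-sym (inj₂ (inj₂ (inj₂ (e , e')))) = inj₂ (inj₂ (inj₁ (e' , e)))

cycAdjℕ-interior : ∀ {m c c'} → 0 < c → suc c < m → CycAdjℕ m c c' → c' ≡ suc c ⊎ suc c' ≡ c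
cycAdjℕ-interior _   _   (inj₁ e)                      = inj₁ e
cycAdjℕ-interior _   _   (inj₂ (inj₁ e))               = inj₂ (sym e)
cycAdjℕ-interior 0<c _   (inj₂ (inj₂ (inj₁ (e , _)))) = ⊥-elim (<⇒≢ 0<c (sym e))
cycAdjℕ-interior _   c<m (inj₂ (inj₂ (inj₂ (e , _)))) = ⊥-elim (<⇒≢ c<m e)

record IsColumnPath (m n : ℕ) (f : ℕ → ℕ) : Set where
  field
    inCycle    : ∀ k → k ≤ n → f k < m
    adjacent   : ∀ k → k < n → CycAdjℕ m (f k) (f (suc k))
    neighbours : ∀ k → suc k < n → ∀ c → CycAdjℕ m (f (suc k)) c → c ≡ f k ⊎ c ≡ f (suc (suc k))

ascending : ∀ {m} b n → b + n < m → IsColumnPath m n (b +_)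
ascending {m} b n b+n<m = record
  { inCycle    = λ k k≤n → ≤-<-trans (+-monoʳ-≤ b k≤n) b+n<m
  ; adjacent   = λ k _ → inj₁ (+-suc b k)
  ; neighbours = neighbours
  }
  where
    neighbours : ∀ k → suc k < n → ∀ c → CycAdjℕ m (b + suc k) c → c ≡ b + k ⊎ c ≡ b + suc (suc k)
    neighbours k 2+k≤n c adj
      with cycAdjℕ-interior (≤-trans (s≤s z≤n) (m≤n+m (suc k) b))
             (subst (_< m) (+-suc b (suc k)) (≤-<-trans (+-monoʳ-≤ b 2+k≤n) b+n<m)) adj
    ... | inj₁ e = inj₂ (trans e (sym (+-suc b (suc k))))
    ... | inj₂ e = inj₁ (suc-injective (trans e (+-suc b k)))

descending : ∀ {m} b n → n ≤ b → b < m → IsColumnPath m n (b ∸_)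
descending {m} b n n≤b b<m = record
  { inCycle    = λ k _ → ≤-<-trans (m∸n≤m b k) b<m
  ; adjacent   = λ k k<n → inj₂ (inj₁ (∸-step k<n))
  ; neighbours = neighbours
  }
  where
    ∸-step : ∀ {k} → k < n → b ∸ k ≡ suc (b ∸ suc k)
    ∸-step k<n = +-∸-assoc 1 (≤-trans k<n n≤b)
    neighbours : ∀ k → suc k < n → ∀ c → CycAdjℕ m (b ∸ suc k) c → c ≡ b ∸ k ⊎ c ≡ b ∸ suc (suc k)
    neighbours k 2+k≤n c adj
      with cycAdjℕ-interior (subst (0 <_) (sym (∸-step 2+k≤n)) z<s)
             (subst (_< m) (∸-step (≤-trans (n≤1+n _) 2+k≤n)) (≤-<-trans (m∸n≤m b k) b<m)) adj
    ... | inj₁ e = inj₁ (trans e (sym (∸-step (≤-trans (n≤1+n _) 2+k≤n))))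
    ... | inj₂ e = inj₂ (suc-injective (trans e (∸-step 2+k≤n)))

m+m≤1+n⇒m≤n : ∀ m {n} → m + m ≤ suc n → m ≤ n
m+m≤1+n⇒m≤n zero    _       = z≤n
m+m≤1+n⇒m≤n (suc m) (s≤s h) = ≤-trans (m≤n+m (suc m) m) h

-- Column c, row l stands for v_{c+1,l+1}; the pendant p_{c+1} sits below row 0.
module Forcing (m r : ℕ) (S : List (WbV m r)) where

  B : WbV m r → Set
  B = Blue (Wb m r) S

  -- Stated for all Fin-representatives, so that it holds vacuously off the grid.
  BlueAt : ℕ → ℕ → Set
  BlueAt c l = ∀ (i : Fin m) (j : Fin r) → toℕ i ≡ c → toℕ j ≡ l → B (inj₁ (i , j))

  BluePendant : ℕ → Set
  BluePendant c = ∀ (i : Fin m) → toℕ i ≡ c → B (inj₂ i)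

  BlueBelow : ℕ → ℕ → Set
  BlueBelow c zero    = BluePendant c
  BlueBelow c (suc l) = BlueAt c l

  blueAt-offTop : ∀ {c l} → r ≤ l → BlueAt c l
  blueAt-offTop r≤l _ j _ refl = ⊥-elim (<⇒≱ (toℕ<n j) r≤l)

  blueAt-offCycle : ∀ {c l} → m ≤ c → BlueAt c l
  blueAt-offCycle m≤c i _ refl _ = ⊥-elim (<⇒≱ (toℕ<n i) m≤c)

  blueBelow-vertex : ∀ {c l l'} → BlueBelow c l → l ≡ suc l' → BlueAt c l'
  blueBelow-vertex below refl = below

  blueBelow-pendant : ∀ {c l} → BlueBelow c l → l ≡ 0 → BluePendant c
  blueBelow-pendant below refl = below

  force-up : ∀ c l → BlueAt c l → (∀ c' → CycAdjℕ m c c' → BlueAt c' l) → BlueBelow c l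
           → BlueAt c (suc l)
  force-up c l here sides below i j' refl j'≡1+l =
    force (here i j refl (toℕ-fromℕ< l<r)) (inj₁ (refl , inj₁ j'≡1+j)) others
    where
      l<r : l < r
      l<r = <-trans (n<1+n l) (subst (_< r) j'≡1+l (toℕ<n j'))
      j : Fin r
      j = fromℕ< l<r
      j'≡1+j : toℕ j' ≡ suc (toℕ j)
      j'≡1+j = trans j'≡1+l (cong suc (sym (toℕ-fromℕ< l<r)))
      others : ∀ x → WbAdj m r (inj₁ (i , j)) x → x ≢ inj₁ (i , j') → B x
      others (inj₁ (_ , k)) (inj₁ (refl , inj₁ k≡1+j)) x≢target =
        ⊥-elim (x≢target (cong (λ k → inj₁ (i , k)) (toℕ-injective (trans k≡1+j (sym j'≡1+j)))))
      others (inj₁ (_ , k)) (inj₁ (refl , inj₂ j≡1+k)) _ =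
        blueBelow-vertex below (trans (sym (toℕ-fromℕ< l<r)) j≡1+k) i k refl refl
      others (inj₁ (i' , _)) (inj₂ (refl , adj)) _ = sides (toℕ i') adj i' j refl (toℕ-fromℕ< l<r)
      others (inj₂ _) (refl , j≡0) _ = blueBelow-pendant below (trans (sym (toℕ-fromℕ< l<r)) j≡0) i refl

  force-along : ∀ c c' l → c < m → CycAdjℕ m c c' → BlueAt c l
              → (∀ c'' → CycAdjℕ m c c'' → c'' ≢ c' → BlueAt c'' l) → BlueAt c (suc l) → BlueBelow c l
              → BlueAt c' l
  force-along c _ _ c<m adj here sides above below i' j refl refl =
    force (here i j i≡c refl) (inj₂ (refl , subst (λ c → CycAdjℕ m c (toℕ i')) (sym i≡c) adj)) others
    where
      i : Fin m
      i = fromℕ< c<m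
      i≡c : toℕ i ≡ c
      i≡c = toℕ-fromℕ< c<m
      others : ∀ x → WbAdj m r (inj₁ (i , j)) x → x ≢ inj₁ (i' , j) → B x
      others (inj₁ (_ , k)) (inj₁ (refl , inj₁ k≡1+j)) _ = above i k i≡c k≡1+j
      others (inj₁ (_ , k)) (inj₁ (refl , inj₂ j≡1+k)) _ = blueBelow-vertex below j≡1+k i k i≡c refl
      others (inj₁ (i'' , _)) (inj₂ (refl , adj')) x≢target =
        sides (toℕ i'') (subst (λ c → CycAdjℕ m c (toℕ i'')) i≡c adj')
          (λ e → x≢target (cong (λ i → inj₁ (i , j)) (toℕ-injective e))) i'' j refl refl
      others (inj₂ _) (refl , j≡0) _ = blueBelow-pendant below j≡0 i i≡c

  force-down : ∀ c l → suc l < r → BlueAt c (suc l) → (∀ c' → CycAdjℕ m c c' → BlueAt c' (suc l))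
             → BlueAt c (suc (suc l)) → BlueAt c l
  force-down c l 1+l<r here sides above i j' refl refl =
    force (here i j refl j≡1+j') (inj₁ (refl , inj₂ j≡1+j')) others
    where
      j : Fin r
      j = fromℕ< 1+l<r
      j≡1+j' : toℕ j ≡ suc (toℕ j')
      j≡1+j' = toℕ-fromℕ< 1+l<r
      others : ∀ x → WbAdj m r (inj₁ (i , j)) x → x ≢ inj₁ (i , j') → B x
      others (inj₁ (_ , k)) (inj₁ (refl , inj₁ k≡1+j)) _ = above i k refl (trans k≡1+j (cong suc j≡1+j'))
      others (inj₁ (_ , k)) (inj₁ (refl , inj₂ j≡1+k)) x≢target =
        ⊥-elim (x≢target (cong (λ k → inj₁ (i , k)) (toℕ-injective (suc-injective (trans (sym j≡1+k) j≡1+j')))))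
      others (inj₁ (i' , _)) (inj₂ (refl , adj)) _ = sides (toℕ i') adj i' j refl j≡1+j'
      others (inj₂ _) (refl , j≡0) _ = ⊥-elim (0≢1+n (trans (sym j≡0) j≡1+j'))

  force-pendant : ∀ c → 0 < r → BlueAt c 0 → (∀ c' → CycAdjℕ m c c' → BlueAt c' 0) → BlueAt c 1
                → BluePendant c
  force-pendant c 0<r here sides above i refl = force (here i j refl j≡0) (refl , j≡0) others
    where
      j : Fin r
      j = fromℕ< 0<r
      j≡0 : toℕ j ≡ 0
      j≡0 = toℕ-fromℕ< 0<r
      others : ∀ x → WbAdj m r (inj₁ (i , j)) x → x ≢ inj₂ i → B x
      others (inj₁ (_ , k)) (inj₁ (refl , inj₁ k≡1+j)) _ = above i k refl (trans k≡1+j (cong suc j≡0))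
      others (inj₁ (_ , k)) (inj₁ (refl , inj₂ j≡1+k)) _ = ⊥-elim (0≢1+n (trans (sym j≡0) j≡1+k))
      others (inj₁ (i' , _)) (inj₂ (refl , adj)) _ = sides (toℕ i') adj i' j refl j≡0
      others (inj₂ _) (refl , _) x≢target = ⊥-elim (x≢target refl)

  pendant-forces : ∀ c → BluePendant c → BlueAt c 0
  pendant-forces c pendant i j refl j≡0 = force (pendant i refl) (refl , j≡0) others
    where
      others : ∀ x → WbAdj m r (inj₂ i) x → x ≢ inj₁ (i , j) → B x
      others (inj₁ (_ , k)) (refl , k≡0) x≢target =
        ⊥-elim (x≢target (cong (λ k → inj₁ (i , k)) (toℕ-injective (trans k≡0 (sym j≡0)))))
      others (inj₂ _) ()

  module Sweeps {n f} (path : IsColumnPath m n f) where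
    open IsColumnPath path

    pyramid : (∀ x → x ≤ n → BluePendant (f x)) → ∀ l x → l ≤ x → x + l ≤ n → BlueAt (f x) l
    pyramid pendants zero x _ x+0≤n =
      pendant-forces (f x) (pendants x (subst (_≤ n) (+-identityʳ x) x+0≤n))
    pyramid pendants (suc l) (suc x) (s≤s l≤x) 1+x+1+l≤n =
      force-up (f (suc x)) l (pyramid pendants l (suc x) (m≤n⇒m≤1+n l≤x) (≤-trans (n≤1+n _) 2+x+l≤n))
        sides (below l l≤x (≤-trans (n≤1+n _) 2+x+l≤n))
      where
        2+x+l≤n : suc (suc x) + l ≤ n
        2+x+l≤n = subst (_≤ n) (cong suc (+-suc x l)) 1+x+1+l≤n
        sides : ∀ c → CycAdjℕ m (f (suc x)) c → BlueAt c l
        sides c adj with neighbours x (≤-trans (m≤m+n (suc (suc x)) l) 2+x+l≤n) c adj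
        ... | inj₁ refl = pyramid pendants l x l≤x (≤-trans (n≤1+n _) (≤-trans (n≤1+n _) 2+x+l≤n))
        ... | inj₂ refl = pyramid pendants l (suc (suc x)) (≤-trans l≤x (≤-trans (n≤1+n x) (n≤1+n _))) 2+x+l≤n
        below : ∀ l' → l' ≤ x → suc x + l' ≤ n → BlueBelow (f (suc x)) l'
        below zero     _      1+x+0≤n     = pendants (suc x) (subst (_≤ n) (+-identityʳ (suc x)) 1+x+0≤n)
        below (suc l') l'<x 1+x+1+l'≤n =
          pyramid pendants l' (suc x) (≤-trans (n≤1+n l') (m≤n⇒m≤1+n l'<x))
            (≤-trans (+-monoʳ-≤ (suc x) (n≤1+n l')) 1+x+1+l'≤n)

    fill : r ≤ n → (∀ x l → l ≤ x → x ≤ r → BlueAt (f x) l) → ∀ x l → x ≤ r → BlueAt (f x) l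
    fill r≤n lower x l = filled l x l (m≤n+m l x)
      where
        Filled : ℕ → Set
        Filled d = ∀ x l → l ≤ x + d → x ≤ r → BlueAt (f x) l

        -- The diagonal l = x + d + 1 is coloured from the top down, each vertex forced by
        -- its neighbour in column f (x + 1), which is already blue above, beside and below.
        diagonal : ∀ d → Filled d → ∀ k x → r ≤ suc (x + d) + k → BlueAt (f x) (suc (x + d))
        diagonal d filled-d zero x r≤l+0 = blueAt-offTop (subst (r ≤_) (+-identityʳ _) r≤l+0)
        diagonal d filled-d (suc k) x r≤l+1+k with suc (x + d) <? r
        ... | no l≮r = blueAt-offTop (≮⇒≥ l≮r)
        ... | yes l<r =
          force-along (f (suc x)) (f x) (suc (x + d)) (inCycle (suc x) (≤-trans 1+x≤r r≤n))
            (cycAdjℕ-sym (adjacent x (≤-trans 1+x≤r r≤n))) (filled-d (suc x) _ ≤-refl 1+x≤r) sides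
            (diagonal d filled-d k (suc x) (subst (r ≤_) (+-suc (suc (x + d)) k) r≤l+1+k))
            (filled-d (suc x) (x + d) (n≤1+n _) 1+x≤r)
          where
            2+x≤r : suc (suc x) ≤ r
            2+x≤r = ≤-trans (s≤s (s≤s (m≤m+n x d))) l<r
            1+x≤r : suc x ≤ r
            1+x≤r = ≤-trans (n≤1+n _) 2+x≤r
            sides : ∀ c → CycAdjℕ m (f (suc x)) c → c ≢ f x → BlueAt c (suc (x + d))
            sides c adj c≢fx with neighbours x (≤-trans 2+x≤r r≤n) c adj
            ... | inj₁ c≡fx = ⊥-elim (c≢fx c≡fx)
            ... | inj₂ refl = filled-d (suc (suc x)) (suc (x + d)) (n≤1+n _) 2+x≤r

        filled : ∀ d → Filled d
        filled zero x l l≤x+0 = lower x l (subst (l ≤_) (+-identityʳ x) l≤x+0)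
        filled (suc d) x l l≤x+1+d with m≤n⇒m<n∨m≡n (subst (l ≤_) (+-suc x d) l≤x+1+d)
        ... | inj₁ l<1+x+d = filled d x l (≤-pred l<1+x+d)
        ... | inj₂ refl    = λ _ → diagonal d (filled d) r x (m≤n+m r _)

    stair : (∀ l → BlueAt (f 0) l) → (∀ l → BlueAt (f 1) l) → BluePendant (f 1)
          → ∀ k → k ≤ n → ∀ l → k ≤ 2 + l → BlueAt (f k) l
    stair column₀ column₁ pendant₁ = go
      where
        go : ∀ k → k ≤ n → ∀ l → k ≤ 2 + l → BlueAt (f k) l
        go zero          _ l _ = column₀ l
        go (suc zero)    _ l _ = column₁ l
        go (suc (suc k)) 2+k≤n l (s≤s (s≤s k≤l)) =
          force-along (f (suc k)) (f (suc (suc k))) l (inCycle (suc k) 1+k≤n) (adjacent (suc k) 2+k≤n)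
            (go (suc k) 1+k≤n l (s≤s (m≤n⇒m≤1+n k≤l))) sides
            (go (suc k) 1+k≤n (suc l) (s≤s (m≤n⇒m≤1+n (m≤n⇒m≤1+n k≤l)))) (below (go (suc k) 1+k≤n) l k≤l)
          where
            1+k≤n : suc k ≤ n
            1+k≤n = ≤-trans (n≤1+n _) 2+k≤n
            sides : ∀ c → CycAdjℕ m (f (suc k)) c → c ≢ f (suc (suc k)) → BlueAt c l
            sides c adj c≢target with neighbours k 2+k≤n c adj
            ... | inj₁ refl      = go k (≤-trans (n≤1+n _) 1+k≤n) l (m≤n⇒m≤1+n (m≤n⇒m≤1+n k≤l))
            ... | inj₂ c≡target = ⊥-elim (c≢target c≡target)
            -- Takes go (suc k) as an argument: a call from here would hide its decrease from
            -- the termination checker.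
            below : (∀ l → suc k ≤ 2 + l → BlueAt (f (suc k)) l) → ∀ l → k ≤ l → BlueBelow (f (suc k)) l
            below _      zero    k≤0   = subst (λ k → BluePendant (f (suc k))) (sym (n≤0⇒n≡0 k≤0)) pendant₁
            below column (suc l) k≤1+l = column l (s≤s k≤1+l)

  fillFromPendants : ∀ {n f} → IsColumnPath m n f → r + r ≤ suc n → (∀ x → x ≤ n → BluePendant (f x))
                   → ∀ x l → x ≤ r → BlueAt (f x) l
  fillFromPendants {f = f} path 2r≤1+n pendants = fill (m+m≤1+n⇒m≤n r 2r≤1+n) lower
    where
      open Sweeps path
      lower : ∀ x l → l ≤ x → x ≤ r → BlueAt (f x) l
      lower x l l≤x x≤r with l <? r
      ... | yes l<r = pyramid pendants l x l≤x (≤-pred (≤-trans (+-mono-≤-< x≤r l<r) 2r≤1+n))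
      ... | no l≮r  = blueAt-offTop (≮⇒≥ l≮r)

  everyRow : (∀ c → BlueAt c (pred r)) → ∀ l c → BlueAt c l
  everyRow top l = rows r l (≤-trans pred[n]≤n (m≤n+m r l))
    where
      rows : ∀ k l → pred r ≤ l + k → ∀ c → BlueAt c l
      rows zero l r-1≤l+0 c with l <? r
      ... | yes l<r = subst (BlueAt c) (≤-antisym (subst (pred r ≤_) (+-identityʳ l) r-1≤l+0) (<⇒≤pred l<r)) (top c)
      ... | no l≮r  = blueAt-offTop (≮⇒≥ l≮r)
      rows (suc k) l r-1≤l+1+k c with suc l <? r
      ... | no 1+l≮r = rows zero l (subst (pred r ≤_) (sym (+-identityʳ l)) (pred-mono-≤ (≮⇒≥ 1+l≮r))) c
      ... | yes 1+l<r =
        force-down c l 1+l<r (rows k (suc l) r-1≤1+l+k c) (λ c' _ → rows k (suc l) r-1≤1+l+k c')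
          (rows k (suc (suc l)) (≤-trans r-1≤1+l+k (n≤1+n _)) c)
        where
          r-1≤1+l+k : pred r ≤ suc l + k
          r-1≤1+l+k = subst (pred r ≤_) (+-suc l k) r-1≤l+1+k

  allBlue-fromTopRow : 0 < r → (∀ c → BlueAt c (pred r)) → IsZeroForcingSet (Wb m r) S
  allBlue-fromTopRow _   top (inj₁ (i , j)) = everyRow top (toℕ j) (toℕ i) i j refl refl
  allBlue-fromTopRow 0<r top (inj₂ i) =
    force-pendant (toℕ i) 0<r (everyRow top 0 _) (λ c _ → everyRow top 0 c) (everyRow top 1 _) i refl

  module Block (a : ℕ) (1≤r : 1 ≤ r) (a≤r : a ≤ r) (a+2r≤m : a + (r + r) ≤ m) (m≤a+2r+r : m ≤ a + (r + r) + r)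
               (pendants : ∀ x → x < r + r → BluePendant (a + x)) where

    p : ℕ
    p = r + r ∸ 2

    width : 2 + p ≡ r + r
    width = m+[n∸m]≡n (+-mono-≤ 1≤r 1≤r)

    x≤1+p⇒x<r+r : ∀ {x} → x ≤ suc p → x < r + r
    x≤1+p⇒x<r+r {x} x≤1+p = subst (x <_) width (s≤s x≤1+p)

    a+1+p<m : a + suc p < m
    a+1+p<m = <-≤-trans (+-monoʳ-< a (n<1+n (suc p))) (subst (λ w → a + w ≤ m) (sym width) a+2r≤m)

    -- Beyond its middle, the block is filled as the first half of the block read backwards.
    block : ∀ y l → y ≤ suc p → BlueAt (a + y) l
    block y l y≤1+p with y ≤? r
    ... | yes y≤r = fillFromPendants (ascending a (suc p) a+1+p<m) (≤-reflexive (sym width))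
                      (λ x x≤1+p → pendants x (x≤1+p⇒x<r+r x≤1+p)) y l y≤r
    ... | no y≰r  = subst (λ c → BlueAt c l) mirror
                      (fillFromPendants (descending (a + suc p) (suc p) (m≤n+m _ a) a+1+p<m)
                         (≤-reflexive (sym width)) mirroredPendants (suc p ∸ y) l 1+p-y≤r)
      where
        mirroredPendants : ∀ x → x ≤ suc p → BluePendant (a + suc p ∸ x)
        mirroredPendants x x≤1+p =
          subst BluePendant (sym (+-∸-assoc a x≤1+p)) (pendants (suc p ∸ x) (x≤1+p⇒x<r+r (m∸n≤m _ x)))
        mirror : a + suc p ∸ (suc p ∸ y) ≡ a + y
        mirror = trans (+-∸-assoc a (m∸n≤m (suc p) y)) (cong (a +_) (m∸[m∸n]≡n y≤1+p))
        1+p-y≤r : suc p ∸ y ≤ r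
        1+p-y≤r = m≤n+o⇒m∸n≤o (suc p) y
          (≤-trans (n≤1+n (suc p)) (≤-trans (≤-reflexive width) (+-monoˡ-≤ r (<⇒≤ (≰⇒> y≰r)))))

    leftStair : ∀ k → k ≤ suc a → ∀ l → k ≤ 2 + l → BlueAt (suc a ∸ k) l
    leftStair = Sweeps.stair (descending (suc a) (suc a) ≤-refl 2+a≤m)
      (λ l → subst (λ c → BlueAt c l) (+-comm a 1) (block 1 l (s≤s z≤n)))
      (λ l → subst (λ c → BlueAt c l) (+-identityʳ a) (block 0 l z≤n))
      (subst BluePendant (+-identityʳ a) (pendants 0 (x≤1+p⇒x<r+r z≤n)))
      where
        2+a≤m : 2 + a ≤ m
        2+a≤m = ≤-trans (≤-reflexive (+-comm 2 a)) (≤-trans (+-monoʳ-≤ a (+-mono-≤ 1≤r 1≤r)) a+2r≤m)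

    rightStair : ∀ k → k ≤ m ∸ suc (a + p) → ∀ l → k ≤ 2 + l → BlueAt (a + p + k) l
    rightStair = Sweeps.stair (ascending (a + p) (m ∸ suc (a + p)) (≤-reflexive (m+[n∸m]≡n a+p<m)))
      (λ l → subst (λ c → BlueAt c l) (sym (+-identityʳ (a + p))) (block p l (n≤1+n p)))
      (λ l → subst (λ c → BlueAt c l) a+1+p≡a+p+1 (block (suc p) l ≤-refl))
      (subst BluePendant a+1+p≡a+p+1 (pendants (suc p) (x≤1+p⇒x<r+r ≤-refl)))
      where
        a+p<m : a + p < m
        a+p<m = <-trans (+-monoʳ-< a (n<1+n p)) a+1+p<m
        a+1+p≡a+p+1 : a + suc p ≡ a + p + 1
        a+1+p≡a+p+1 = trans (+-suc a p) (+-comm 1 (a + p))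

    2+[r-1]≡1+r : 2 + pred r ≡ suc r
    2+[r-1]≡1+r = cong suc (suc-pred r {{>-nonZero 1≤r}})

    topRow-left : ∀ c → c ≤ a → BlueAt c (pred r)
    topRow-left c c≤a = subst (λ c → BlueAt c (pred r)) (m∸[m∸n]≡n (m≤n⇒m≤1+n c≤a))
      (leftStair (suc a ∸ c) (m∸n≤m _ c) (pred r)
         (≤-trans (m∸n≤m _ c) (subst (suc a ≤_) (sym 2+[r-1]≡1+r) (s≤s a≤r))))

    topRow-middle : ∀ c → a ≤ c → c ≤ a + suc p → BlueAt c (pred r)
    topRow-middle c a≤c c≤a+1+p = subst (λ c → BlueAt c (pred r)) (m+[n∸m]≡n a≤c)
      (block (c ∸ a) (pred r) (subst (c ∸ a ≤_) (m+n∸m≡n a (suc p)) (∸-monoˡ-≤ a c≤a+1+p)))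

    topRow-right : ∀ c → a + p ≤ c → c < m → BlueAt c (pred r)
    topRow-right c a+p≤c c<m = subst (λ c → BlueAt c (pred r)) (m+[n∸m]≡n a+p≤c)
      (rightStair (c ∸ (a + p)) (∸-monoˡ-≤ (suc (a + p)) c<m) (pred r)
         (subst (c ∸ (a + p) ≤_) (sym 2+[r-1]≡1+r) (m≤n+o⇒m∸n≤o c (a + p) c≤a+p+1+r)))
      where
        regroup : ∀ a p r → a + (2 + p) + r ≡ suc (a + p + suc r)
        regroup = solve-∀
        c≤a+p+1+r : c ≤ a + p + suc r
        c≤a+p+1+r = ≤-pred (≤-trans c<m (subst (m ≤_) (regroup a p r) (subst (λ w → m ≤ a + w + r) (sym width) m≤a+2r+r)))

    topRow : ∀ c → BlueAt c (pred r)
    topRow c with c ≤? a | c ≤? a + suc p | c <? m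
    ... | yes c≤a | _             | _       = topRow-left c c≤a
    ... | no c≰a  | yes c≤a+1+p   | _       = topRow-middle c (<⇒≤ (≰⇒> c≰a)) c≤a+1+p
    ... | no _    | no c≰a+1+p    | yes c<m = topRow-right c (≤-trans (+-monoʳ-≤ a (n≤1+n p)) (<⇒≤ (≰⇒> c≰a+1+p))) c<m
    ... | no _    | no _          | no c≮m  = blueAt-offCycle (≮⇒≥ c≮m)

    allBlue : IsZeroForcingSet (Wb m r) S
    allBlue = allBlue-fromTopRow 1≤r topRow

module PendantColumns (m r a w : ℕ) (a+w≤m : a + w ≤ m) where

  pendant : Fin w → WbV m r
  pendant x = inj₂ (fromℕ< (<-≤-trans (+-monoʳ-< a (toℕ<n x)) a+w≤m))

  pendants : List (WbV m r)
  pendants = map pendant (allFin w)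

  pendants-unique : Unique pendants
  pendants-unique = map⁺ pendant-injective (allFin⁺ w)
    where
      pendant-injective : ∀ {x y} → pendant x ≡ pendant y → x ≡ y
      pendant-injective e = toℕ-injective (+-cancelˡ-≡ a _ _
        (trans (sym (toℕ-fromℕ< _)) (trans (cong toℕ (inj₂-injective e)) (toℕ-fromℕ< _))))

  pendants-length : length pendants ≡ w
  pendants-length = trans (length-map pendant (allFin w)) (length-tabulate (λ x → x))

  pendants-blue : ∀ x → x < w → Forcing.BluePendant m r pendants (a + x)
  pendants-blue x x<w i i≡a+x = init (subst (_∈ pendants) (sym i≡pendant) (∈-map⁺ pendant (∈-allFin (fromℕ< x<w))))
    where
      i≡pendant : inj₂ i ≡ pendant (fromℕ< x<w)
      i≡pendant = cong inj₂ (toℕ-injective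
        (trans i≡a+x (sym (trans (toℕ-fromℕ< _) (cong (a +_) (toℕ-fromℕ< x<w))))))

⌈n/2⌉≤k⇒n≤k+k : ∀ n {k} → ⌈ n /2⌉ ≤ k → n ≤ k + k
⌈n/2⌉≤k⇒n≤k+k n {k} ⌈n/2⌉≤k = begin
  n                   ≡⟨ ⌊n/2⌋+⌈n/2⌉≡n n ⟨
  ⌊ n /2⌋ + ⌈ n /2⌉   ≤⟨ +-monoˡ-≤ ⌈ n /2⌉ (⌊n/2⌋≤⌈n/2⌉ n) ⟩
  ⌈ n /2⌉ + ⌈ n /2⌉   ≤⟨ +-mono-≤ ⌈n/2⌉≤k ⌈n/2⌉≤k ⟩
  k + k               ∎
  where open ≤-Reasoning

blockStart : ℕ → ℕ → ℕ
blockStart m r = m ∸ (r + r) ∸ r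

blockStart≤r : ∀ m r → m ≤ (r + r) + (r + r) → blockStart m r ≤ r
blockStart≤r m r m≤4r = m≤n+o⇒m∸n≤o (m ∸ (r + r)) r (m≤n+o⇒m∸n≤o m (r + r) m≤4r)

blockStart+2r≤m : ∀ m r → r + r ≤ m → blockStart m r + (r + r) ≤ m
blockStart+2r≤m m r 2r≤m = ≤-trans (+-monoˡ-≤ (r + r) (m∸n≤m _ r)) (≤-reflexive (m∸n+n≡m 2r≤m))

m≤blockStart+2r+r : ∀ m r → m ≤ blockStart m r + (r + r) + r
m≤blockStart+2r+r m r = begin
  m                         ≤⟨ m≤n+m∸n m (r + r) ⟩
  (r + r) + (m ∸ (r + r))   ≤⟨ +-monoʳ-≤ (r + r) (m≤n+m∸n (m ∸ (r + r)) r) ⟩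
  (r + r) + (r + a)         ≡⟨ regroup (r + r) r a ⟩
  a + (r + r) + r           ∎
  where
    open ≤-Reasoning
    a : ℕ
    a = blockStart m r
    regroup : ∀ w r a → w + (r + a) ≡ a + w + r
    regroup = solve-∀

mainTheorem6 : (m r : ℕ) → 3 ≤ m → 1 ≤ r → ⌈ m /2⌉ < 2 * r → 2 * r < m
    → Z≤ (Wb m r) (2 * r)
mainTheorem6 m r _ 1≤r ⌈m/2⌉<2r 2r<m =
  pendants , pendants-unique ,
  Forcing.Block.allBlue m r pendants a 1≤r
    (blockStart≤r m r (⌈n/2⌉≤k⇒n≤k+k m (<⇒≤ (subst (⌈ m /2⌉ <_) 2r≡r+r ⌈m/2⌉<2r))))
    a+2r≤m (m≤blockStart+2r+r m r) pendants-blue ,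
  ≤-reflexive (trans pendants-length (sym 2r≡r+r))
  where
    2r≡r+r : 2 * r ≡ r + r
    2r≡r+r = cong (r +_) (+-identityʳ r)
    a : ℕ
    a = blockStart m r
    a+2r≤m : a + (r + r) ≤ m
    a+2r≤m = blockStart+2r≤m m r (<⇒≤ (subst (_< m) 2r≡r+r 2r<m))
    open PendantColumns m r a (r + r) a+2r≤m
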